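{- Let $G$ be a minimal counterexample and $B=\overline{G}$. If $x_1,x_2$ are non-adjacent vertices of $B$, then $x_1$ and $x_2$ have at most one common neighbor in $B$.
   Context: A minimal counterexample is a simple graph $G$ of order $n\ge 5$ with at least $\binom{n}{2}-n+5$ edges that has no orientation of diameter two, chosen of minimum order among all such graphs and, subject to that, of minimum size. $\overline{G}$ is the complement of $G$. -}

module Defs where

open import Data.Nat using (ℕ; zero; suc; _+_; _≤_; _<_; _≥_)
open import Data.Nat.Combinatorics using (_C_)
open import Data.Bool using (Bool; true; false; _∧_; if_then_else_)
open import Data.Fin using (Fin; zero; suc; toℕ)
open import Data.Nat using (_<ᵇ_)
open import Data.Product using (Σ; ∃; _×_; _,_)
open import Data.Sum using (_⊎_)
open import Relation.Binary.PropositionalEquality using (_≡_; _≢_; refl; sym; cong₂)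
open import Data.Bool using (not)
open import Data.Fin using (_≟_)
open import Relation.Nullary using (does; yes; no)
open import Data.Empty using (⊥-elim)
open import Relation.Nullary using (¬_)

record Graph (n : ℕ) : Set where
  field
    adj    : Fin n → Fin n → Bool
    adj-sym : ∀ i j → adj i j ≡ adj j i
    irrefl : ∀ i → adj i i ≡ false
open Graph public

count : ∀ {n} → (Fin n → Bool) → ℕ
count {zero}  p = 0
count {suc n} p = (if p zero then 1 else 0) + count (λ i → p (suc i))

sumFin : ∀ {n} → (Fin n → ℕ) → ℕ
sumFin {zero}  f = 0
sumFin {suc n} f = f zero + sumFin (λ i → f (suc i))

size : ∀ {n} → Graph n → ℕ
size {n} G = sumFin (λ i → count (λ j → (toℕ i <ᵇ toℕ j) ∧ adj G i j))

record Orientation {n : ℕ} (G : Graph n) : Set where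
  field
    arc      : Fin n → Fin n → Bool
    arc-edge : ∀ i j → arc i j ≡ true → adj G i j ≡ true
    antisym  : ∀ i j → arc i j ≡ true → arc j i ≡ false
    total    : ∀ i j → adj G i j ≡ true → (arc i j ≡ true) ⊎ (arc j i ≡ true)
open Orientation public

-- The orientation has diameter (at most) two: every ordered pair of distinct vertices
-- is joined by a directed path of length at most 2.  (For n ≥ 2 an oriented graph never
-- has diameter ≤ 1, so this is the same as diameter exactly two.)
DiameterTwo : ∀ {n} {G : Graph n} → Orientation G → Set
DiameterTwo {n} O =
  ∀ (u v : Fin n) → u ≢ v →
    (arc O u v ≡ true) ⊎ (Σ (Fin n) λ w → (arc O u w ≡ true) × (arc O w v ≡ true))

-- Counterexample: order n ≥ 5, at least C(n,2) - n + 5 edges (written additively,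
-- equivalent since C(n,2) ≥ n for n ≥ 5), and no orientation of diameter two.
Counterexample : ∀ {n} → Graph n → Set
Counterexample {n} G =
  (n ≥ 5) × (size G + n ≥ (n C 2) + 5) × ¬ (Σ (Orientation G) DiameterTwo)

MinimalCounterexample : ∀ {n} → Graph n → Set
MinimalCounterexample {n} G =
  Counterexample G ×
  (∀ (m : ℕ) (H : Graph m) → Counterexample H →
     (n < m) ⊎ ((n ≡ m) × (size G ≤ size H)))

notEq : ∀ {n} → Fin n → Fin n → Bool
notEq i j = not (does (i ≟ j))

notEq-sym : ∀ {n} (i j : Fin n) → notEq i j ≡ notEq j i
notEq-sym i j with i ≟ j | j ≟ i
... | yes _ | yes _ = refl
... | no _  | no _  = refl
... | yes p | no q  = ⊥-elim (q (sym p))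
... | no p  | yes q = ⊥-elim (p (sym q))

notEq-refl : ∀ {n} (i : Fin n) → notEq i i ≡ false
notEq-refl i with i ≟ i
... | yes _ = refl
... | no p  = ⊥-elim (p refl)

complement : ∀ {n} → Graph n → Graph n
complement G = record
  { adj    = λ i j → if adj G i j then false else notEq i j
  ; adj-sym = λ i j → cong₂ (λ a b → if a then false else b) (adj-sym G i j) (notEq-sym i j)
  ; irrefl = λ i → cong₂ (λ a b → if a then false else b) (irrefl G i) (notEq-refl i)
  }

commonNeighbours : ∀ {n} → Graph n → Fin n → Fin n → ℕ
commonNeighbours G x y = count (λ w → adj G x w ∧ adj G y w)

-- In G, x₁x₂ is an edge whose endpoints have two common non-neighbours y₁, y₂.  Delete x₂
-- and keep x₁ adjacent only to the common neighbours of x₁ and x₂ other than one fixed common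
-- neighbour w (to nobody if there is none).  The resulting graph H on n − 1 vertices loses at
-- most deg x₂ + |N(x₁) ∖ N[x₂]| + 1 = |N(x₁) ∪ N(x₂)| ≤ n − 2 edges, since y₁, y₂ lie outside
-- that union; so H still meets the edge bound and, by minimality of the order, is not a
-- counterexample.  Without a common neighbour x₁ is isolated in H, so H has no orientation of
-- diameter two.  Otherwise an orientation of H of diameter two lifts to G: an edge of G is
-- oriented like its image under the map identifying x₂ with x₁ when that image is an edge of
-- H, and by a tournament containing the directed triangle x₁ → x₂ → w → x₁ otherwise; the
-- triangle supplies the paths between x₁ and x₂.
module Submission where

open import Defs
open import Data.Bool using (Bool; true; false; _∧_; _∨_; not; if_then_else_)
open import Data.Bool.Properties using (¬-not; ∧-comm; ∧-identityʳ; ∧-zeroʳ)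
import Data.Bool.Properties as Bool
open import Data.Empty using (⊥; ⊥-elim)
open import Data.Fin using (Fin; zero; suc; punchIn; punchOut; _≟_)
open import Data.Fin.Patterns using (0F; 1F; 2F)
open import Data.Fin.Properties
  using (punchInᵢ≢i; punchIn-punchOut; punchOut-punchIn; punchOut-cong; 0≢1+n; suc-injective;
         _<?_; <-cmp; any?)
open import Data.Nat using (ℕ; zero; suc; _+_; _*_; _≤_; _≥_; z≤n; s≤s)
open import Data.Nat.Combinatorics using (_C_; nC1≡n; nCk+nC[k+1]≡[n+1]C[k+1])
open import Data.Nat.Properties
  using (+-0-commutativeMonoid; ≤-refl; ≤-trans; ≤-reflexive; ≤-pred; +-assoc;
         +-identityʳ; +-mono-≤; +-monoˡ-≤; +-monoʳ-≤; +-cancelˡ-≤; *-distribˡ-+; *-cancelˡ-≡;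
         <-asym; n<1+n; 1+n≢n; module ≤-Reasoning)
open import Data.Nat.Tactic.RingSolver using (solve-∀)
open import Algebra.Properties.CommutativeMonoid.Sum +-0-commutativeMonoid
  using (sum; sum-remove; ∑-distrib-+; ∑-comm; sum-cong-≗; sum-replicate-zero)
open import Data.Product using (Σ; _×_; _,_; proj₁; proj₂)
open import Data.Sum using (_⊎_; inj₁; inj₂)
open import Function using (_∘_)
open import Relation.Binary.Definitions using (tri<; tri≈; tri>)
open import Relation.Binary.PropositionalEquality
open import Relation.Nullary using (¬_; does; yes; no; contradiction)
open import Relation.Nullary.Decidable using (dec-true; dec-false)

ind : Bool → ℕ
ind b = if b then 1 else 0

ind≤1 : ∀ b → ind b ≤ 1
ind≤1 true  = s≤s z≤n
ind≤1 false = z≤n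

ind-split : ∀ b c → ind b ≡ ind (b ∧ not c) + ind (b ∧ c)
ind-split true  true  = refl
ind-split true  false = refl
ind-split false c     = refl

ind-∨-bound : ∀ p q c → ind q + ind (p ∧ not c) ≤ ind (p ∨ q) + ind ((p ∧ q) ∧ not c)
ind-∨-bound true  true  c = ≤-refl
ind-∨-bound true  false c = ind≤1 (not c)
ind-∨-bound false true  c = ≤-refl
ind-∨-bound false false c = z≤n

∧-elimˡ : ∀ {b c} → b ∧ c ≡ true → b ≡ true
∧-elimˡ {true} _ = refl

∧-elimʳ : ∀ {b c} → b ∧ c ≡ true → c ≡ true
∧-elimʳ {true} e = e

+-double : ∀ a b → a + (a + b) ≡ 2 * a + b
+-double = solve-∀

pascal : ∀ n → suc n C 2 ≡ n + n C 2
pascal n = trans (sym (nCk+nC[k+1]≡[n+1]C[k+1] n 1)) (cong (_+ n C 2) (nC1≡n n))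

sum-+₃ : ∀ {n} (f g h : Fin n → ℕ) → sum (λ i → f i + (g i + h i)) ≡ sum f + (sum g + sum h)
sum-+₃ f g h = trans (∑-distrib-+ f (λ i → g i + h i)) (cong (sum f +_) (∑-distrib-+ g h))

sum-mono-≤ : ∀ {n} {f g : Fin n → ℕ} → (∀ i → f i ≤ g i) → sum f ≤ sum g
sum-mono-≤ {zero}  f≤g = z≤n
sum-mono-≤ {suc n} f≤g = +-mono-≤ (f≤g zero) (sum-mono-≤ (f≤g ∘ suc))

sum≤length : ∀ {n} (f : Fin n → ℕ) → (∀ i → f i ≤ 1) → sum f ≤ n
sum≤length {zero}  f f≤1 = z≤n
sum≤length {suc n} f f≤1 = +-mono-≤ (f≤1 zero) (sum≤length (f ∘ suc) (f≤1 ∘ suc))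

sum-select : ∀ {n} (r : Fin n) (f : Fin n → ℕ) →
             sum (λ k → if does (k ≟ r) then f k else 0) ≡ f r
sum-select {suc n} r f = begin
  sum g                       ≡⟨ sum-remove {i = r} g ⟩
  g r + sum (g ∘ punchIn r)   ≡⟨ cong₂ _+_ (cong (λ b → if b then f r else 0) (dec-true (r ≟ r) refl))
                                           (sum-cong-≗ λ k → cong (λ b → if b then f (punchIn r k) else 0)
                                                                  (dec-false (punchIn r k ≟ r) (punchInᵢ≢i r k))) ⟩
  f r + sum {n} (λ _ → 0)     ≡⟨ cong (f r +_) (sum-replicate-zero n) ⟩
  f r + 0                     ≡⟨ +-identityʳ (f r) ⟩
  f r                         ∎
  where
  open ≡-Reasoning
  g : Fin (suc n) → ℕ
  g k = if does (k ≟ r) then f k else 0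

count≡sum : ∀ {n} (p : Fin n → Bool) → count p ≡ sum (ind ∘ p)
count≡sum {zero}  p = refl
count≡sum {suc n} p = cong (ind (p zero) +_) (count≡sum (p ∘ suc))

count≤length : ∀ {n} (p : Fin n → Bool) → count p ≤ n
count≤length p = ≤-trans (≤-reflexive (count≡sum p)) (sum≤length (ind ∘ p) (ind≤1 ∘ p))

count-none : ∀ {n} (p : Fin n → Bool) → (∀ i → p i ≡ false) → count p ≡ 0
count-none {zero}  p none = refl
count-none {suc n} p none rewrite none zero = count-none (p ∘ suc) (none ∘ suc)

count≤1 : ∀ {n} (p : Fin n → Bool) → (∀ i j → p i ≡ true → p j ≡ true → i ≡ j) → count p ≤ 1
count≤1 {zero}  p unique = z≤n
count≤1 {suc n} p unique with p zero in p0
... | true  = s≤s (≤-reflexive (count-none (p ∘ suc) λ i → ¬-not λ pi → 0≢1+n (unique zero (suc i) p0 pi)))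
... | false = count≤1 (p ∘ suc) λ i j pi pj → suc-injective (unique (suc i) (suc j) pi pj)

count+2≤length : ∀ {n} (p : Fin n → Bool) {y₁ y₂ : Fin n} → y₁ ≢ y₂ →
                 p y₁ ≡ false → p y₂ ≡ false → count p + 2 ≤ n
count+2≤length {n} p {y₁} {y₂} y₁≢y₂ py₁ py₂ = begin
  count p + 2                       ≡⟨ cong₂ (λ c s → c + (s + 1)) (count≡sum p) (sym (sum-select y₁ λ _ → 1)) ⟩
  sum P + (sum δ₁ + 1)              ≡⟨ cong (λ s → sum P + (sum δ₁ + s)) (sym (sum-select y₂ λ _ → 1)) ⟩
  sum P + (sum δ₁ + sum δ₂)         ≡⟨ sum-+₃ P δ₁ δ₂ ⟨
  sum (λ i → P i + (δ₁ i + δ₂ i))   ≤⟨ sum≤length _ atMostOne ⟩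
  n                                 ∎
  where
  open ≤-Reasoning
  P δ₁ δ₂ : Fin n → ℕ
  P i  = ind (p i)
  δ₁ i = ind (does (i ≟ y₁))
  δ₂ i = ind (does (i ≟ y₂))
  atMostOne : ∀ i → P i + (δ₁ i + δ₂ i) ≤ 1
  atMostOne i with i ≟ y₁ | i ≟ y₂
  ... | yes refl | yes refl = contradiction refl y₁≢y₂
  ... | yes refl | no _     rewrite py₁ = ≤-refl
  ... | no _     | yes refl rewrite py₂ = ≤-refl
  ... | no _     | no _     = ≤-trans (≤-reflexive (+-identityʳ (P i))) (ind≤1 (p i))

deleteVertex : ∀ {n} → Graph (suc n) → Fin (suc n) → Graph n
deleteVertex G x = record
  { adj     = λ k l → adj G (punchIn x k) (punchIn x l)
  ; adj-sym = λ k l → adj-sym G (punchIn x k) (punchIn x l)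
  ; irrefl  = λ k → irrefl G (punchIn x k)
  }

allowedAt : ∀ {n} → Fin n → (Fin n → Bool) → Fin n → Fin n → Bool
allowedAt r K k l = not (does (k ≟ r)) ∨ K l

restrictAt : ∀ {n} → Graph n → Fin n → (Fin n → Bool) → Graph n
restrictAt S r K = record
  { adj     = λ k l → adj S k l ∧ (allowedAt r K k l ∧ allowedAt r K l k)
  ; adj-sym = λ k l → cong₂ _∧_ (adj-sym S k l) (∧-comm (allowedAt r K k l) (allowedAt r K l k))
  ; irrefl  = λ k → cong (_∧ (allowedAt r K k k ∧ allowedAt r K k k)) (irrefl S k)
  }

restrictAt-⊆ : ∀ {n} (S : Graph n) (r : Fin n) (K : Fin n → Bool) {k l} →
               adj (restrictAt S r K) k l ≡ true → adj S k l ≡ true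
restrictAt-⊆ S r K = ∧-elimˡ

restrictAt-at : ∀ {n} (S : Graph n) (r : Fin n) (K : Fin n → Bool) {l} →
                adj (restrictAt S r K) r l ≡ true → K l ≡ true
restrictAt-at S r K {l} e rewrite dec-true (r ≟ r) refl = ∧-elimˡ (∧-elimʳ {adj S r l} e)

pullback : ∀ {n m} → (Fin n → Fin m) → Graph m → Graph n
pullback φ H = record
  { adj     = λ u v → adj H (φ u) (φ v)
  ; adj-sym = λ u v → adj-sym H (φ u) (φ v)
  ; irrefl  = λ u → irrefl H (φ u)
  }

complement-adj⇒¬adj : ∀ {n} (G : Graph n) {x y} → adj (complement G) x y ≡ true → adj G x y ≡ false
complement-adj⇒¬adj G {x} {y} e with adj G x y
... | false = refl

complement-¬adj⇒adj : ∀ {n} (G : Graph n) {x y} → x ≢ y → adj (complement G) x y ≡ false → adj G x y ≡ true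
complement-¬adj⇒adj G {x} {y} x≢y e with adj G x y
... | true  = refl
... | false = contradiction (trans (sym e) (cong not (dec-false (x ≟ y) x≢y))) λ ()

degree : ∀ {n} → Graph n → Fin n → ℕ
degree G u = sum (λ v → ind (adj G u v))

degreeSum : ∀ {n} → Graph n → ℕ
degreeSum G = sum (degree G)

degree-punchIn : ∀ {n} (G : Graph (suc n)) (x : Fin (suc n)) →
                 degree G x ≡ sum (λ k → ind (adj G x (punchIn x k)))
degree-punchIn G x = trans (sum-remove {i = x} (λ v → ind (adj G x v)))
                           (cong (λ b → ind b + sum (λ k → ind (adj G x (punchIn x k)))) (irrefl G x))

degreeSum-deleteVertex : ∀ {n} (G : Graph (suc n)) (x : Fin (suc n)) →
                         degreeSum G ≡ 2 * degree G x + degreeSum (deleteVertex G x)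
degreeSum-deleteVertex G x = begin
  degreeSum G
    ≡⟨ sum-remove {i = x} (degree G) ⟩
  d + sum (degree G ∘ punchIn x)
    ≡⟨ cong (d +_) (sum-cong-≗ λ k → sum-remove {i = x} (λ v → ind (adj G (punchIn x k) v))) ⟩
  d + sum (λ k → ind (adj G (punchIn x k) x) + degree G′ k)
    ≡⟨ cong (d +_) (∑-distrib-+ (λ k → ind (adj G (punchIn x k) x)) (degree G′)) ⟩
  d + (sum (λ k → ind (adj G (punchIn x k) x)) + degreeSum G′)
    ≡⟨ cong (λ s → d + (s + degreeSum G′)) (sum-cong-≗ λ k → cong ind (adj-sym G (punchIn x k) x)) ⟩
  d + (sum (λ k → ind (adj G x (punchIn x k))) + degreeSum G′)
    ≡⟨ cong (λ s → d + (s + degreeSum G′)) (degree-punchIn G x) ⟨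
  d + (d + degreeSum G′)
    ≡⟨ +-double d (degreeSum G′) ⟩
  2 * d + degreeSum G′
    ∎
  where
  open ≡-Reasoning
  d = degree G x
  G′ = deleteVertex G x

module _ {n} (S : Graph n) (r : Fin n) (K : Fin n → Bool) where

  private
    S′ = restrictAt S r K

    removedAt : Fin n → ℕ
    removedAt l = ind (adj S r l ∧ not (K l))

    edgeSplit : ∀ k l → ind (adj S k l) ≡ (if does (k ≟ r) then removedAt l else 0)
                                         + ((if does (l ≟ r) then removedAt k else 0) + ind (adj S′ k l))
    edgeSplit k l with k ≟ r | l ≟ r
    ... | yes refl | yes refl rewrite irrefl S r = refl
    ... | yes refl | no _     rewrite ∧-identityʳ (K l) = ind-split (adj S r l) (K l)
    ... | no _     | yes refl rewrite adj-sym S k r = ind-split (adj S r k) (K k)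
    ... | no _     | no _     = cong ind (sym (∧-identityʳ (adj S k l)))

  degreeSum-restrictAt : degreeSum S ≡ 2 * sum (λ l → ind (adj S r l ∧ not (K l))) + degreeSum (restrictAt S r K)
  degreeSum-restrictAt = begin
    degreeSum S
      ≡⟨ sum-cong-≗ (λ k → trans (sum-cong-≗ (edgeSplit k)) (sum-+₃ (A k) (B k) (λ l → ind (adj S′ k l)))) ⟩
    sum (λ k → sum (A k) + (sum (B k) + degree S′ k))
      ≡⟨ sum-+₃ (sum ∘ A) (sum ∘ B) (degree S′) ⟩
    sum (sum ∘ A) + (sum (sum ∘ B) + degreeSum S′)
      ≡⟨ cong₂ (λ a b → a + (b + degreeSum S′)) ΣA ΣB ⟩
    sum removedAt + (sum removedAt + degreeSum S′)
      ≡⟨ +-double (sum removedAt) (degreeSum S′) ⟩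
    2 * sum removedAt + degreeSum S′
      ∎
    where
    open ≡-Reasoning
    A B : Fin n → Fin n → ℕ
    A k l = if does (k ≟ r) then removedAt l else 0
    B k l = if does (l ≟ r) then removedAt k else 0
    ΣA : sum (sum ∘ A) ≡ sum removedAt
    ΣA = trans (∑-comm A) (sum-cong-≗ λ l → sum-select r (λ _ → removedAt l))
    ΣB : sum (sum ∘ B) ≡ sum removedAt
    ΣB = sum-cong-≗ λ k → sum-select r (λ _ → removedAt k)

handshake : ∀ {n} (G : Graph n) → 2 * size G ≡ degreeSum G
handshake {zero}  G = refl
handshake {suc n} G = begin
  2 * size G                                          ≡⟨⟩
  2 * (count (adj G zero ∘ suc) + size G′)            ≡⟨ *-distribˡ-+ 2 (count (adj G zero ∘ suc)) (size G′) ⟩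
  2 * count (adj G zero ∘ suc) + 2 * size G′          ≡⟨ cong₂ (λ c s → 2 * c + s)
                                                               (trans (count≡sum (adj G zero ∘ suc)) (sym (degree-punchIn G zero)))
                                                               (handshake G′) ⟩
  2 * degree G zero + degreeSum G′                    ≡⟨ degreeSum-deleteVertex G zero ⟨
  degreeSum G                                         ∎
  where
  open ≡-Reasoning
  G′ = deleteVertex G zero

size≤C2 : ∀ {n} (G : Graph n) → size G ≤ n C 2
size≤C2 {zero}  G = z≤n
size≤C2 {suc n} G = begin
  count (adj G zero ∘ suc) + size (deleteVertex G zero)  ≤⟨ +-mono-≤ (count≤length _) (size≤C2 (deleteVertex G zero)) ⟩
  n + n C 2                                              ≡⟨ pascal n ⟨
  suc n C 2                                              ∎
  where open ≤-Reasoning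

record Tournament (n : ℕ) : Set where
  field
    beats       : Fin n → Fin n → Bool
    beats-asym  : ∀ u v → beats u v ≡ true → beats v u ≡ false
    beats-total : ∀ u v → u ≢ v → beats u v ≡ true ⊎ beats v u ≡ true
open Tournament

module _ {n} (P : Fin n → Fin n → Bool) (P-asym : ∀ u v → P u v ≡ true → P v u ≡ false) where

  private
    beatsP : Fin n → Fin n → Bool
    beatsP u v = if P u v then true else if P v u then false else does (u <? v)

    beatsP-asym : ∀ u v → beatsP u v ≡ true → beatsP v u ≡ false
    beatsP-asym u v e with P u v in puv | P v u in pvu
    ... | true  | true  = contradiction (trans (sym pvu) (P-asym u v puv)) λ ()
    ... | true  | false = refl
    ... | false | false with <-cmp u v
    ...   | tri< _ _ v≮u = dec-false (v <? u) v≮u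
    ...   | tri≈ u≮v _ _ = contradiction (trans (sym e) (dec-false (u <? v) u≮v)) λ ()
    ...   | tri> u≮v _ _ = contradiction (trans (sym e) (dec-false (u <? v) u≮v)) λ ()

    beatsP-total : ∀ u v → u ≢ v → beatsP u v ≡ true ⊎ beatsP v u ≡ true
    beatsP-total u v u≢v with P u v | P v u
    ... | true  | _     = inj₁ refl
    ... | false | true  = inj₂ refl
    ... | false | false with <-cmp u v
    ...   | tri< u<v _ _ = inj₁ (dec-true (u <? v) u<v)
    ...   | tri≈ _ u≡v _ = contradiction u≡v u≢v
    ...   | tri> _ _ v<u = inj₂ (dec-true (v <? u) v<u)

  extendTournament : Tournament n
  extendTournament = record { beats = beatsP ; beats-asym = beatsP-asym ; beats-total = beatsP-total }

  extendTournament-⊇ : ∀ {u v} → P u v ≡ true → beats extendTournament u v ≡ true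
  extendTournament-⊇ e rewrite e = refl

cyclicSucc : Fin 3 → Fin 3 → Bool
cyclicSucc 0F 1F = true
cyclicSucc 1F 2F = true
cyclicSucc 2F 0F = true
cyclicSucc _  _  = false

cyclicSucc-asym : ∀ i j → cyclicSucc i j ≡ true → cyclicSucc j i ≡ false
cyclicSucc-asym 0F 1F _  = refl
cyclicSucc-asym 1F 2F _  = refl
cyclicSucc-asym 2F 0F _  = refl
cyclicSucc-asym 0F 0F ()
cyclicSucc-asym 0F 2F ()
cyclicSucc-asym 1F 0F ()
cyclicSucc-asym 1F 1F ()
cyclicSucc-asym 2F 1F ()
cyclicSucc-asym 2F 2F ()

-- The labelling need not be injective: pulling back an asymmetric relation keeps it asymmetric.
cyclicTournament : ∀ {n} → (Fin n → Fin 3) → Tournament n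
cyclicTournament label =
  extendTournament (λ u v → cyclicSucc (label u) (label v)) (λ u v → cyclicSucc-asym (label u) (label v))

cyclicTournament-beats : ∀ {n} (label : Fin n → Fin 3) {u v : Fin n} →
                         cyclicSucc (label u) (label v) ≡ true → beats (cyclicTournament label) u v ≡ true
cyclicTournament-beats label =
  extendTournament-⊇ (λ u v → cyclicSucc (label u) (label v)) (λ u v → cyclicSucc-asym (label u) (label v))

pullbackᵒ : ∀ {n m} (φ : Fin n → Fin m) {H : Graph m} → Orientation H → Orientation (pullback φ H)
pullbackᵒ φ O = record
  { arc      = λ u v → arc O (φ u) (φ v)
  ; arc-edge = λ u v → arc-edge O (φ u) (φ v)
  ; antisym  = λ u v → antisym O (φ u) (φ v)
  ; total    = λ u v → total O (φ u) (φ v)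
  }

module _ {n} (G S : Graph n) (O : Orientation S) (T : Tournament n) where

  overlayArc : Fin n → Fin n → Bool
  overlayArc u v = adj G u v ∧ (if adj S u v then arc O u v else beats T u v)

  private
    overlayArc-asym : ∀ u v → overlayArc u v ≡ true → overlayArc v u ≡ false
    overlayArc-asym u v e rewrite adj-sym S v u with adj S u v
    ... | true  = trans (cong (adj G v u ∧_) (antisym O u v (∧-elimʳ e))) (∧-zeroʳ (adj G v u))
    ... | false = trans (cong (adj G v u ∧_) (beats-asym T u v (∧-elimʳ e))) (∧-zeroʳ (adj G v u))

    overlayArc-total : ∀ u v → adj G u v ≡ true → overlayArc u v ≡ true ⊎ overlayArc v u ≡ true
    overlayArc-total u v e rewrite adj-sym S v u | adj-sym G v u | e with adj S u v in s
    ... | true  = total O u v s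
    ... | false = beats-total T u v λ { refl → contradiction (trans (sym e) (irrefl G u)) λ () }

  overlay : Orientation G
  overlay = record
    { arc      = overlayArc
    ; arc-edge = λ u v → ∧-elimˡ
    ; antisym  = overlayArc-asym
    ; total    = overlayArc-total
    }

  overlay-arcˢ : ∀ {u v} → adj G u v ≡ true → arc O u v ≡ true → overlayArc u v ≡ true
  overlay-arcˢ {u} {v} e a rewrite e | arc-edge O u v a | a = refl

  overlay-arcᵗ : ∀ {u v} → adj G u v ≡ true → adj S u v ≡ false → beats T u v ≡ true → overlayArc u v ≡ true
  overlay-arcᵗ e s b rewrite e | s | b = refl

anotherVertex : ∀ {m} → 2 ≤ m → (r : Fin m) → Σ (Fin m) (r ≢_)
anotherVertex (s≤s (s≤s _)) zero    = 1F , λ ()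
anotherVertex (s≤s (s≤s _)) (suc _) = 0F , λ ()

isolated⇒¬diameterTwo : ∀ {m} (H : Graph m) (r : Fin m) → (∀ l → adj H r l ≢ true) → 2 ≤ m →
                        ¬ Σ (Orientation H) DiameterTwo
isolated⇒¬diameterTwo H r isolated 2≤m (O , d₂) with anotherVertex 2≤m r
... | v , r≢v with d₂ r v r≢v
...   | inj₁ r→v           = isolated v (arc-edge O r v r→v)
...   | inj₂ (w , r→w , _) = isolated w (arc-edge O r w r→w)

module Reduction {m : ℕ} (G : Graph (suc m)) (x₂ : Fin (suc m)) (r : Fin m) (K : Fin m → Bool) where

  x₁ : Fin (suc m)
  x₁ = punchIn x₂ r

  H : Graph m
  H = restrictAt (deleteVertex G x₂) r K

  private
    N₁ N₂ : Fin m → Bool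
    N₁ k = adj G x₁ (punchIn x₂ k)
    N₂ k = adj G x₂ (punchIn x₂ k)

  lost : ℕ
  lost = sum (λ k → ind (N₁ k ∧ not (K k)))

  union : ℕ
  union = sum (λ k → ind (N₁ k ∨ N₂ k))

  missed : ℕ
  missed = count (λ k → (N₁ k ∧ N₂ k) ∧ not (K k))

  size-reduction : size G ≡ size H + (degree G x₂ + lost)
  size-reduction = *-cancelˡ-≡ (size G) _ 2 (begin
    2 * size G                                    ≡⟨ handshake G ⟩
    degreeSum G                                   ≡⟨ degreeSum-deleteVertex G x₂ ⟩
    2 * degree G x₂ + degreeSum G′                ≡⟨ cong (2 * degree G x₂ +_) (degreeSum-restrictAt G′ r K) ⟩
    2 * degree G x₂ + (2 * lost + degreeSum H)    ≡⟨ cong (λ s → 2 * degree G x₂ + (2 * lost + s)) (handshake H) ⟨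
    2 * degree G x₂ + (2 * lost + 2 * size H)     ≡⟨ regroup (degree G x₂) lost (size H) ⟩
    2 * (size H + (degree G x₂ + lost))           ∎)
    where
    open ≡-Reasoning
    G′ = deleteVertex G x₂
    regroup : ∀ d l s → 2 * d + (2 * l + 2 * s) ≡ 2 * (s + (d + l))
    regroup = solve-∀

  loss-bound : degree G x₂ + lost ≤ union + missed
  loss-bound = begin
    degree G x₂ + lost                                     ≡⟨ cong (_+ lost) (degree-punchIn G x₂) ⟩
    sum (ind ∘ N₂) + lost                                  ≡⟨ ∑-distrib-+ (ind ∘ N₂) _ ⟨
    sum (λ k → ind (N₂ k) + ind (N₁ k ∧ not (K k)))        ≤⟨ sum-mono-≤ (λ k → ind-∨-bound (N₁ k) (N₂ k) (K k)) ⟩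
    sum (λ k → ind (N₁ k ∨ N₂ k) + ind ((N₁ k ∧ N₂ k) ∧ not (K k)))
                                                           ≡⟨ ∑-distrib-+ (λ k → ind (N₁ k ∨ N₂ k)) _ ⟩
    union + sum (λ k → ind ((N₁ k ∧ N₂ k) ∧ not (K k)))    ≡⟨ cong (union +_) (count≡sum (λ k → (N₁ k ∧ N₂ k) ∧ not (K k))) ⟨
    union + missed                                         ∎
    where open ≤-Reasoning

  union+2≤m : adj G x₁ x₂ ≡ true → ∀ {y₁ y₂} → y₁ ≢ y₂ →
              adj G x₁ y₁ ∨ adj G x₂ y₁ ≡ false → adj G x₁ y₂ ∨ adj G x₂ y₂ ≡ false →
              union + 2 ≤ m
  union+2≤m x₁x₂ y₁≢y₂ y₁∉ y₂∉ = ≤-pred (begin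
    suc (union + 2)                 ≡⟨ cong (λ b → ind (b ∨ adj G x₂ x₂) + union + 2) x₁x₂ ⟨
    ind (N x₂) + union + 2          ≡⟨ cong (_+ 2) (sum-remove {i = x₂} (ind ∘ N)) ⟨
    sum (ind ∘ N) + 2               ≡⟨ cong (_+ 2) (count≡sum N) ⟨
    count N + 2                     ≤⟨ count+2≤length N y₁≢y₂ y₁∉ y₂∉ ⟩
    suc m                           ∎)
    where
    open ≤-Reasoning
    N : Fin (suc m) → Bool
    N u = adj G x₁ u ∨ adj G x₂ u

  size-drop : union + 2 ≤ m → missed ≤ 1 → size G + 1 ≤ size H + m
  size-drop union+2≤m missed≤1 = begin
    size G + 1                          ≡⟨ cong (_+ 1) size-reduction ⟩
    size H + (degree G x₂ + lost) + 1   ≡⟨ +-assoc (size H) _ 1 ⟩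
    size H + (degree G x₂ + lost + 1)   ≤⟨ +-monoʳ-≤ (size H) (+-monoˡ-≤ 1 (≤-trans loss-bound (+-monoʳ-≤ union missed≤1))) ⟩
    size H + (union + 1 + 1)            ≡⟨ cong (size H +_) (+-assoc union 1 1) ⟩
    size H + (union + 2)                ≤⟨ +-monoʳ-≤ (size H) union+2≤m ⟩
    size H + m                          ∎
    where open ≤-Reasoning

module Lift {m : ℕ} (G : Graph (suc m)) (x₂ : Fin (suc m)) (r w′ : Fin m) (K : Fin m → Bool)
            (K⊆N₂ : ∀ l → K l ≡ true → adj G x₂ (punchIn x₂ l) ≡ true) (w′∉K : K w′ ≡ false)
            (x₁x₂ : adj G (punchIn x₂ r) x₂ ≡ true) (x₁w : adj G (punchIn x₂ r) (punchIn x₂ w′) ≡ true)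
            (x₂w : adj G x₂ (punchIn x₂ w′) ≡ true)
            where

  open Reduction G x₂ r K using (x₁; H)

  w : Fin (suc m)
  w = punchIn x₂ w′

  merge : Fin (suc m) → Fin m
  merge u with x₂ ≟ u
  ... | yes _    = r
  ... | no x₂≢u = punchOut x₂≢u

  merge-x₂ : merge x₂ ≡ r
  merge-x₂ with x₂ ≟ x₂
  ... | yes _    = refl
  ... | no x₂≢x₂ = contradiction refl x₂≢x₂

  merge-punchIn : ∀ k → merge (punchIn x₂ k) ≡ k
  merge-punchIn k with x₂ ≟ punchIn x₂ k
  ... | yes x₂≡k′ = contradiction (sym x₂≡k′) (punchInᵢ≢i x₂ k)
  ... | no _      = trans (punchOut-cong x₂ refl) (punchOut-punchIn x₂)

  data MergeView : Fin (suc m) → Set where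
    at-x₂      : MergeView x₂
    at-punchIn : ∀ k → MergeView (punchIn x₂ k)

  mergeView : ∀ u → MergeView u
  mergeView u with x₂ ≟ u
  ... | yes refl = at-x₂
  ... | no x₂≢u  = subst MergeView (punchIn-punchOut x₂≢u) (at-punchIn (punchOut x₂≢u))

  edges-lift : ∀ u v → adj H (merge u) (merge v) ≡ true → adj G u v ≡ true
  edges-lift u v with mergeView u | mergeView v
  ... | at-x₂        | at-x₂        = λ e → contradiction (trans (sym e) (irrefl H (merge x₂))) λ ()
  ... | at-x₂        | at-punchIn l rewrite merge-x₂ | merge-punchIn l =
    K⊆N₂ l ∘ restrictAt-at (deleteVertex G x₂) r K
  ... | at-punchIn k | at-x₂        rewrite merge-x₂ | merge-punchIn k =
    λ e → trans (adj-sym G _ x₂) (K⊆N₂ k (restrictAt-at (deleteVertex G x₂) r K (trans (adj-sym H r k) e)))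
  ... | at-punchIn k | at-punchIn l rewrite merge-punchIn k | merge-punchIn l =
    restrictAt-⊆ (deleteVertex G x₂) r K

  merge-collision : ∀ {u v} → u ≢ v → merge u ≡ merge v → (u ≡ x₁ × v ≡ x₂) ⊎ (u ≡ x₂ × v ≡ x₁)
  merge-collision {u} {v} u≢v eq with mergeView u | mergeView v
  ... | at-x₂        | at-x₂        = contradiction refl u≢v
  ... | at-x₂        | at-punchIn l = inj₂ (refl , cong (punchIn x₂) (sym (trans (sym merge-x₂) (trans eq (merge-punchIn l)))))
  ... | at-punchIn k | at-x₂        = inj₁ (cong (punchIn x₂) (trans (sym (merge-punchIn k)) (trans eq merge-x₂)) , refl)
  ... | at-punchIn k | at-punchIn l =
    contradiction (cong (punchIn x₂) (trans (sym (merge-punchIn k)) (trans eq (merge-punchIn l)))) u≢v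

  private
    x₁≢x₂ : x₁ ≢ x₂
    x₁≢x₂ = punchInᵢ≢i x₂ r

    w≢x₂ : w ≢ x₂
    w≢x₂ = punchInᵢ≢i x₂ w′

    w≢x₁ : w ≢ x₁
    w≢x₁ w≡x₁ = contradiction (trans (sym x₁w) (trans (cong (adj G x₁) w≡x₁) (irrefl G x₁))) λ ()

  label : Fin (suc m) → Fin 3
  label u = if does (u ≟ x₁) then 0F else if does (u ≟ x₂) then 1F else 2F

  private
    label-x₁ : label x₁ ≡ 0F
    label-x₁ rewrite dec-true (x₁ ≟ x₁) refl = refl

    label-x₂ : label x₂ ≡ 1F
    label-x₂ rewrite dec-false (x₂ ≟ x₁) (x₁≢x₂ ∘ sym) | dec-true (x₂ ≟ x₂) refl = refl

    label-w : label w ≡ 2F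
    label-w rewrite dec-false (w ≟ x₁) w≢x₁ | dec-false (w ≟ x₂) w≢x₂ = refl

    r≁w′ : adj H r w′ ≡ false
    r≁w′ = ¬-not λ e → contradiction (trans (sym w′∉K) (restrictAt-at (deleteVertex G x₂) r K e)) λ ()

  liftDiameterTwo : Σ (Orientation H) DiameterTwo → Σ (Orientation G) DiameterTwo
  liftDiameterTwo (O , d₂) = overlay G S Oₛ T , d₂G
    where
    S = pullback merge H
    Oₛ = pullbackᵒ merge O
    T = cyclicTournament label

    arc-lift : ∀ {u v} → arc O (merge u) (merge v) ≡ true → overlayArc G S Oₛ T u v ≡ true
    arc-lift {u} {v} a = overlay-arcˢ G S Oₛ T (edges-lift u v (arc-edge O _ _ a)) a

    arc-x₁x₂ : overlayArc G S Oₛ T x₁ x₂ ≡ true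
    arc-x₁x₂ = overlay-arcᵗ G S Oₛ T x₁x₂
      (trans (cong₂ (adj H) (merge-punchIn r) merge-x₂) (irrefl H r))
      (cyclicTournament-beats label {x₁} {x₂} (cong₂ cyclicSucc label-x₁ label-x₂))

    arc-x₂w : overlayArc G S Oₛ T x₂ w ≡ true
    arc-x₂w = overlay-arcᵗ G S Oₛ T x₂w
      (trans (cong₂ (adj H) merge-x₂ (merge-punchIn w′)) r≁w′)
      (cyclicTournament-beats label {x₂} {w} (cong₂ cyclicSucc label-x₂ label-w))

    arc-wx₁ : overlayArc G S Oₛ T w x₁ ≡ true
    arc-wx₁ = overlay-arcᵗ G S Oₛ T (trans (adj-sym G w x₁) x₁w)
      (trans (cong₂ (adj H) (merge-punchIn w′) (merge-punchIn r)) (trans (adj-sym H w′ r) r≁w′))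
      (cyclicTournament-beats label {w} {x₁} (cong₂ cyclicSucc label-w label-x₁))

    d₂G : DiameterTwo (overlay G S Oₛ T)
    d₂G u v u≢v with merge u ≟ merge v
    ... | no merge-u≢v with d₂ (merge u) (merge v) merge-u≢v
    ...   | inj₁ a             = inj₁ (arc-lift a)
    ...   | inj₂ (k , a₁ , a₂) = inj₂ (punchIn x₂ k ,
              arc-lift (subst (λ z → arc O (merge u) z ≡ true) (sym (merge-punchIn k)) a₁) ,
              arc-lift (subst (λ z → arc O z (merge v) ≡ true) (sym (merge-punchIn k)) a₂))
    d₂G u v u≢v | yes merge-u≡v with merge-collision u≢v merge-u≡v
    ...   | inj₁ (refl , refl) = inj₁ arc-x₁x₂
    ...   | inj₂ (refl , refl) = inj₂ (w , arc-x₂w , arc-wx₁)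

module _ {m} {G : Graph (suc m)} (minimal : MinimalCounterexample G) where

  private
    order≥5 : suc m ≥ 5
    order≥5 = proj₁ (proj₁ minimal)

    edgesG : size G + suc m ≥ suc m C 2 + 5
    edgesG = proj₁ (proj₂ (proj₁ minimal))

    noDiameterTwo : ¬ Σ (Orientation G) DiameterTwo
    noDiameterTwo = proj₂ (proj₂ (proj₁ minimal))

  noSmallerCounterexample : (H : Graph m) → ¬ Counterexample H
  noSmallerCounterexample H ce with proj₂ minimal m H ce
  ... | inj₁ 1+m<m       = <-asym 1+m<m (n<1+n m)
  ... | inj₂ (1+m≡m , _) = 1+n≢n 1+m≡m

  2≤m : 2 ≤ m
  2≤m = ≤-trans (s≤s (s≤s z≤n)) (≤-pred order≥5)

  sizeDrop⇒¬¬diameterTwo : (H : Graph m) → size G + 1 ≤ size H + m → ¬ ¬ Σ (Orientation H) DiameterTwo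
  sizeDrop⇒¬¬diameterTwo H drop noH = noSmallerCounterexample H (orderH≥5 , edgesH , noH)
    where
    edgesH : size H + m ≥ m C 2 + 5
    edgesH = ≤-trans (+-cancelˡ-≤ m _ _ (begin
      m + (m C 2 + 5)      ≡⟨ +-assoc m (m C 2) 5 ⟨
      m + m C 2 + 5        ≡⟨ cong (_+ 5) (pascal m) ⟨
      suc m C 2 + 5        ≤⟨ edgesG ⟩
      size G + suc m       ≡⟨ shift (size G) m ⟩
      m + (size G + 1)     ∎)) drop
      where
      open ≤-Reasoning
      shift : ∀ s m → s + suc m ≡ m + (s + 1)
      shift = solve-∀
    orderH≥5 : m ≥ 5
    orderH≥5 = +-cancelˡ-≤ (m C 2) 5 m (≤-trans edgesH (+-monoˡ-≤ m (size≤C2 H)))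

  noTwoCommonNonNeighbours : ∀ x₂ r → adj G (punchIn x₂ r) x₂ ≡ true → ∀ {y₁ y₂} → y₁ ≢ y₂ →
                             adj G (punchIn x₂ r) y₁ ∨ adj G x₂ y₁ ≡ false →
                             adj G (punchIn x₂ r) y₂ ∨ adj G x₂ y₂ ≡ false → ⊥
  noTwoCommonNonNeighbours x₂ r x₁x₂ y₁≢y₂ y₁∉ y₂∉
    with any? (λ k → adj G (punchIn x₂ r) (punchIn x₂ k) ∧ adj G x₂ (punchIn x₂ k) Bool.≟ true)
  ... | yes (w′ , common) =
    sizeDrop⇒¬¬diameterTwo H
      (size-drop (union+2≤m x₁x₂ y₁≢y₂ y₁∉ y₂∉) (count≤1 _ λ i j mi mj → trans (missed⇒w′ i mi) (sym (missed⇒w′ j mj))))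
      (noDiameterTwo ∘ Lift.liftDiameterTwo G x₂ r w′ K (λ _ → ∧-elimˡ) w′∉K x₁x₂ (∧-elimˡ common) (∧-elimʳ common))
    where
    K : Fin m → Bool
    K l = adj G x₂ (punchIn x₂ l) ∧ not (does (l ≟ w′))
    open Reduction G x₂ r K
    w′∉K : K w′ ≡ false
    w′∉K = trans (cong (λ b → adj G x₂ (punchIn x₂ w′) ∧ not b) (dec-true (w′ ≟ w′) refl)) (∧-zeroʳ _)
    missed⇒w′ : ∀ i → (adj G x₁ (punchIn x₂ i) ∧ adj G x₂ (punchIn x₂ i)) ∧ not (K i) ≡ true → i ≡ w′
    missed⇒w′ i e with i ≟ w′
    ... | yes i≡w′ = i≡w′
    ... | no _     = contradiction (trans (sym (∧-elimʳ {x₁∼i ∧ x₂∼i} e))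
                                          (cong (λ b → not (b ∧ true)) (∧-elimʳ {x₁∼i} (∧-elimˡ e)))) λ ()
      where
      x₁∼i x₂∼i : Bool
      x₁∼i = adj G x₁ (punchIn x₂ i)
      x₂∼i = adj G x₂ (punchIn x₂ i)
  ... | no noCommon =
    sizeDrop⇒¬¬diameterTwo H
      (size-drop (union+2≤m x₁x₂ y₁≢y₂ y₁∉ y₂∉) (count≤1 _ λ i _ mi _ → contradiction (i , ∧-elimˡ mi) noCommon))
      (isolated⇒¬diameterTwo H r (λ l e → contradiction (restrictAt-at (deleteVertex G x₂) r (λ _ → false) e) λ ()) 2≤m)
    where open Reduction G x₂ r (λ _ → false)

lemma8 : ∀ {n : ℕ} (G : Graph n) → MinimalCounterexample G →
         ∀ (x₁ x₂ : Fin n) → x₁ ≢ x₂ → adj (complement G) x₁ x₂ ≡ false →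
         commonNeighbours (complement G) x₁ x₂ ≤ 1
lemma8 {suc m} G minimal x₁ x₂ x₁≢x₂ nonadjacent
  with punchOut (x₁≢x₂ ∘ sym) | punchIn-punchOut (x₁≢x₂ ∘ sym)
... | r | refl = count≤1 _ unique
  where
  B = complement G
  nonNeighbour : ∀ {y} → adj B x₁ y ∧ adj B x₂ y ≡ true → adj G x₁ y ∨ adj G x₂ y ≡ false
  nonNeighbour c = cong₂ _∨_ (complement-adj⇒¬adj G (∧-elimˡ c)) (complement-adj⇒¬adj G (∧-elimʳ c))
  unique : ∀ y₁ y₂ → adj B x₁ y₁ ∧ adj B x₂ y₁ ≡ true → adj B x₁ y₂ ∧ adj B x₂ y₂ ≡ true → y₁ ≡ y₂
  unique y₁ y₂ c₁ c₂ with y₁ ≟ y₂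
  ... | yes y₁≡y₂ = y₁≡y₂
  ... | no y₁≢y₂  = ⊥-elim (noTwoCommonNonNeighbours minimal x₂ r (complement-¬adj⇒adj G x₁≢x₂ nonadjacent)
                                                     y₁≢y₂ (nonNeighbour c₁) (nonNeighbour c₂))
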